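{- Let $k\ge 2$ and let $(C_{2k},\sigma)$ be a signed even cycle $v_1v_2\cdots v_{2k}$ with a list assignment $L$ satisfying one of the following: (1) for even $i$, $L(v_i)$ is a neighbored $5$-set, and for odd $i$, $L(v_i)$ is a paired $10$-set; (2) $L(v_1)=C$, $L(v_2)$ is a paired $8$-set with four elements in $C^+$ and four in $C^-$, $L(v_{2k})$ is a neighbored $5$-set, and for every other $i$, $L(v_i)$ is a paired $10$-set if $i$ is even and a neighbored $5$-set if $i$ is odd; (3) $L(v_1)=C$, $L(v_2)$ and $L(v_{2k})$ are neighbored $5$-sets, $L(v_3)$ is a paired $8$-set with four elements in $C^+$ and four in $C^-$, and for every other $i$ (if any), $L(v_i)$ is a neighbored $5$-set if $i$ is odd and a paired $10$-set if $i$ is even. Then $(C_{2k},\sigma)$ is $L$-colorable.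
   Context: A signed cycle carries a signature $\sigma:E\to\{+,-\}$. Let $C=\{i^+,i^-:1\le i\le 6\}$ be the vertex set of ${\rm DSG}(K_6,M)$ with signature $m^*$: for $i\ne j$ and $\alpha\in\{+,-\}$, $i^\alpha j^\alpha$ is an edge, negative if $\{i,j\}\in\{\{1,2\},\{3,4\},\{5,6\}\}$ and positive otherwise; $i^\alpha j^{ -\alpha}$ is an edge, positive if $\{i,j\}\in\{\{1,2\},\{3,4\},\{5,6\}\}$ and negative otherwise; $i^+,i^-$ are non-adjacent. $C^+=\{i^+\}$, $C^-=\{i^-\}$. The pair of $(2l-1)^\alpha$ is $(2l)^\alpha$ and vice versa; a layer is $\{(2l-1)^+,(2l)^+,(2l-1)^-,(2l)^-\}$, $l=1,2,3$. A set $L\subseteq C$ is paired if all but at most one of its elements have their pair in $L$; a paired $n$-set is a paired set of size $n$. A neighbored $5$-set is a set of size $5$, no three elements in a common layer, consisting of two pairs contained in one of $C^+,C^-$ and one element of the other. An $L$-coloring is a map $\phi$ with $\phi(v)\in L(v)$ such that each edge $uv$ maps to an edge $\phi(u)\phi(v)$ of ${\rm DSG}(K_6,M)$ with $m^*(\phi(u)\phi(v))=\sigma(uv)$. -}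

module Defs where

open import Data.Bool using (Bool; true; false; _∧_; _∨_; not; if_then_else_)
open import Data.Nat using (ℕ; zero; suc; _≤_; _%_; _*_)
open import Data.Fin using (Fin; zero; suc; toℕ) renaming (_≟_ to _≟F_)
open import Data.Fin.Patterns
open import Data.List using (List; []; _∷_; length; filterᵇ; map; concatMap)
open import Data.Product using (_×_; _,_; proj₁; proj₂; Σ; ∃)
open import Data.Sum using (_⊎_)
open import Relation.Nullary using (¬_)
open import Relation.Nullary.Decidable using (⌊_⌋)
open import Relation.Binary.PropositionalEquality using (_≡_; _≢_)

data Sgn : Set where
  plus minus : Sgn

opp : Sgn → Sgn
opp plus = minus
opp minus = plus

_==S_ : Sgn → Sgn → Bool
plus ==S plus = true
minus ==S minus = true
_ ==S _ = false

-- The vertex set C = { i^+, i^- : 1 ≤ i ≤ 6 } of DSG(K_6, M).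
-- Index i ∈ Fin 6 stands for the paper's i+1; so the perfect matching
-- M = {{1,2},{3,4},{5,6}} becomes {{0,1},{2,3},{4,5}}.
C : Set
C = Fin 6 × Sgn

idx : C → Fin 6
idx = proj₁

sgn : C → Sgn
sgn = proj₂

mate : Fin 6 → Fin 6
mate 0F = 1F
mate 1F = 0F
mate 2F = 3F
mate 3F = 2F
mate 4F = 5F
mate 5F = 4F

pairOf : C → C
pairOf (i , α) = (mate i , α)

layerIdx : Fin 6 → Fin 3
layerIdx 0F = 0F
layerIdx 1F = 0F
layerIdx 2F = 1F
layerIdx 3F = 1F
layerIdx 4F = 2F
layerIdx 5F = 2F

layer : C → Fin 3
layer x = layerIdx (idx x)

inM : Fin 6 → Fin 6 → Bool
inM i j = ⌊ mate i ≟F j ⌋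

DSGAdj : C → C → Set
DSGAdj x y = idx x ≢ idx y

mStar : C → C → Sgn
mStar (i , α) (j , β) =
  if α ==S β
  then (if inM i j then minus else plus)
  else (if inM i j then plus else minus)

allFin6 : List (Fin 6)
allFin6 = 0F ∷ 1F ∷ 2F ∷ 3F ∷ 4F ∷ 5F ∷ []

allC : List C
allC = concatMap (λ i → (i , plus) ∷ (i , minus) ∷ []) allFin6

SubC : Set
SubC = C → Bool

_∈S_ : C → SubC → Set
x ∈S L = L x ≡ true

countWhere : SubC → (C → Bool) → ℕ
countWhere L P = length (filterᵇ (λ x → L x ∧ P x) allC)

size : SubC → ℕ
size L = countWhere L (λ _ → true)

Paired : SubC → Set
Paired L = countWhere L (λ x → not (L (pairOf x))) ≤ 1

PairedSet : ℕ → SubC → Set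
PairedSet n L = Paired L × size L ≡ n

BalancedPaired8 : SubC → Set
BalancedPaired8 L =
  PairedSet 8 L
  × countWhere L (λ x → sgn x ==S plus) ≡ 4
  × countWhere L (λ x → sgn x ==S minus) ≡ 4

NoThreeInLayer : SubC → Set
NoThreeInLayer L = (l : Fin 3) → countWhere L (λ x → ⌊ layer x ≟F l ⌋) ≤ 2

Neighbored5 : SubC → Set
Neighbored5 L =
  size L ≡ 5 × NoThreeInLayer L ×
  Σ Sgn λ α → Σ C λ x → Σ C λ y → Σ C λ z →
    sgn x ≡ α × sgn y ≡ α × sgn z ≡ opp α ×
    ((c : C) → c ∈S L →
       (c ≡ x) ⊎ (c ≡ pairOf x) ⊎ (c ≡ y) ⊎ (c ≡ pairOf y) ⊎ (c ≡ z)) ×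
    x ∈S L × pairOf x ∈S L × y ∈S L × pairOf y ∈S L × z ∈S L

Full : SubC → Set
Full L = (c : C) → c ∈S L

-- Signed cycle C_n with vertices v_1 … v_n encoded by Fin n
-- (index i ∈ Fin n is v_{i+1}); σ i is the sign of the edge v_{i+1} v_{i+2}
-- (indices mod n).
CycEdge : (n : ℕ) → Fin n → Fin n → Set
CycEdge n i j = (suc (toℕ i) ≡ toℕ j) ⊎ (suc (toℕ i) ≡ n × toℕ j ≡ 0)

pos : ∀ {n} → Fin n → ℕ
pos i = suc (toℕ i)

IsEven IsOdd : ℕ → Set
IsEven m = m % 2 ≡ 0
IsOdd m = m % 2 ≡ 1

LColoring : (n : ℕ) → (Fin n → Sgn) → (Fin n → SubC) → (Fin n → C) → Set
LColoring n σ L φ =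
  ((i : Fin n) → φ i ∈S L i) ×
  ((i j : Fin n) → CycEdge n i j →
     DSGAdj (φ i) (φ j) × mStar (φ i) (φ j) ≡ σ i)

LColorable : (n : ℕ) → (Fin n → Sgn) → (Fin n → SubC) → Set
LColorable n σ L = Σ (Fin n → C) λ φ → LColoring n σ L φ

Cond1 : (k : ℕ) → (Fin (2 * k) → SubC) → Set
Cond1 k L = (i : Fin (2 * k)) →
  (IsEven (pos i) → Neighbored5 (L i)) × (IsOdd (pos i) → PairedSet 10 (L i))

Cond2 : (k : ℕ) → (Fin (2 * k) → SubC) → Set
Cond2 k L = (i : Fin (2 * k)) →
  (pos i ≡ 1 → Full (L i)) ×
  (pos i ≡ 2 → BalancedPaired8 (L i)) ×
  (pos i ≡ 2 * k → Neighbored5 (L i)) ×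
  (pos i ≢ 1 → pos i ≢ 2 → pos i ≢ 2 * k →
     (IsEven (pos i) → PairedSet 10 (L i)) × (IsOdd (pos i) → Neighbored5 (L i)))

Cond3 : (k : ℕ) → (Fin (2 * k) → SubC) → Set
Cond3 k L = (i : Fin (2 * k)) →
  (pos i ≡ 1 → Full (L i)) ×
  (pos i ≡ 2 → Neighbored5 (L i)) ×
  (pos i ≡ 2 * k → Neighbored5 (L i)) ×
  (pos i ≡ 3 → BalancedPaired8 (L i)) ×
  (pos i ≢ 1 → pos i ≢ 2 → pos i ≢ 3 → pos i ≢ 2 * k →
     (IsOdd (pos i) → Neighbored5 (L i)) × (IsEven (pos i) → PairedSet 10 (L i)))

-- Switching a vertex (replacing its colour i^α by i^-α, which flips the signs of both incident edges) brings
-- every list to contain one of four normal forms: the positive colours of two layers together with one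
-- negative colour of the third (neighbored), everything but the positive half of one layer (paired 10-set),
-- everything but the positive half of one layer and the negative half of another (balanced paired 8-set),
-- or everything. Fix one representative colour per layer in each neighbored list. Between two such hubs the
-- intermediate vertices induce a relation on the three layers, and through a paired 10-set this relation
-- contains a permutation and at least five of the nine pairs. Following these permutations along the regular
-- stretch of the cycle, the two irregular segments close it as soon as together they relate more than nine
-- pairs: by pigeonhole on the 3 × 3 grid they then share a pair. All local facts are finite and decided by
-- evaluation.

module Submission where

open import Defs
open import Data.Bool using (Bool; true; false; T; _∧_; _∨_; not; if_then_else_)
open import Data.Bool.ListAction using (all; any)
open import Data.Bool.Properties using (T-≡)
open import Data.Fin using (Fin; zero; suc; toℕ) renaming (_≟_ to _≟ᶠ_)
open import Data.Fin.Patterns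
open import Data.Fin.Permutation using (Permutation′; permutation; _⟨$⟩ʳ_; _∘ₚ_; flip) renaming (id to idₚ)
open import Data.Fin.Properties using (any?; toℕ-injective; toℕ<n; toℕ-fromℕ<)
open import Data.List using (List; []; _∷_; cartesianProduct; allFin; filterᵇ; map; length)
open import Data.List.Membership.Propositional using (_∈_)
open import Data.List.Membership.Propositional.Properties using (∈-allFin; ∈-cartesianProduct⁺; ∈-map⁺)
open import Data.List.Relation.Unary.All as All using (All)
open import Data.List.Relation.Unary.All.Properties using (all⁺; all⁻)
open import Data.List.Relation.Unary.Any using (here; there; satisfied)
open import Data.List.Relation.Unary.Any.Properties using (any⁻)
open import Data.Nat using (ℕ; zero; suc; _≤_; _<_; _≤?_; _≤ᵇ_; _≡ᵇ_; _+_; _*_; z≤n; s≤s; NonZero)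
open import Data.Nat.DivMod using (_mod_; _%_; m<n⇒m%n≡m; [m+n]%n≡m%n; m%n<n)
open import Data.Nat.Properties
  using (≤ᵇ⇒≤; ≤⇒≤ᵇ; ≡⇒≡ᵇ; ≡ᵇ⇒≡; +-mono-≤; +-monoʳ-≤; *-monoʳ-≤; ≤-refl; ≤-trans; <⇒≱; >⇒≢; <⇒≢;
         *-identityʳ; +-identityʳ; +-comm; m≤m+n; n≤1+n; n<1+n; m≤n⇒m<n∨m≡n; m<n⇒m<1+n; m≤n⇒m≤1+n;
         module ≤-Reasoning)
open import Algebra.Properties.CommutativeMonoid.Sum Data.Nat.Properties.+-0-commutativeMonoid
  using (sum; sum-syntax; ∑-comm; ∑-distrib-+; sum-permute; sum-cong-≗)
open import Data.Nat.Tactic.RingSolver using (solve-∀)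
open import Data.Product using (Σ; ∃₂; _×_; _,_; proj₁; proj₂; uncurry)
open import Data.Product.Properties using (≡-dec)
open import Data.Sum using (_⊎_; inj₁; inj₂)
open import Data.Unit using (⊤; tt)
open import Data.Vec using (Vec; []; _∷_; lookup; tabulate)
open import Data.Vec.Properties using (lookup∘tabulate)
open import Function using (_∘_; Equivalence)
open import Relation.Binary.Definitions using (DecidableEquality)
open import Relation.Binary.PropositionalEquality
  using (_≡_; _≢_; refl; sym; trans; cong; cong₂; subst; subst₂; module ≡-Reasoning)
open import Relation.Nullary using (Dec; yes; no; map′; contradiction)
open import Relation.Nullary.Decidable using (⌊_⌋; toWitness; fromWitness; ¬?; _×-dec_; T?)

infixl 7 _·_

_·_ : Sgn → Sgn → Sgn
plus  · s = s
minus · s = opp s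

opp-involutive : ∀ s → opp (opp s) ≡ s
opp-involutive plus  = refl
opp-involutive minus = refl

·-assoc : ∀ a b c → a · b · c ≡ a · (b · c)
·-assoc plus  b     c = refl
·-assoc minus plus  c = refl
·-assoc minus minus c = sym (opp-involutive c)

·-comm : ∀ a b → a · b ≡ b · a
·-comm plus  plus  = refl
·-comm plus  minus = refl
·-comm minus plus  = refl
·-comm minus minus = refl

·-self : ∀ a → a · a ≡ plus
·-self plus  = refl
·-self minus = refl

·-identityʳ : ∀ a → a · plus ≡ a
·-identityʳ plus  = refl
·-identityʳ minus = refl

·-interchange : ∀ a α b β → a · α · (b · β) ≡ a · b · (α · β)
·-interchange a α b β = begin
  a · α · (b · β)   ≡⟨ ·-assoc a α (b · β) ⟩
  a · (α · (b · β)) ≡⟨ cong (a ·_) (trans (sym (·-assoc α b β)) (trans (cong (_· β) (·-comm α b)) (·-assoc b α β))) ⟩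
  a · (b · (α · β)) ≡⟨ sym (·-assoc a b (α · β)) ⟩
  a · b · (α · β)   ∎
  where open ≡-Reasoning

infix 4 _≟ₛ_ _≟ᶜ_

_≟ₛ_ : DecidableEquality Sgn
plus  ≟ₛ plus  = yes refl
minus ≟ₛ minus = yes refl
plus  ≟ₛ minus = no λ ()
minus ≟ₛ plus  = no λ ()

_≟ᶜ_ : DecidableEquality C
_≟ᶜ_ = ≡-dec _≟ᶠ_ _≟ₛ_

matchSign : Fin 6 → Fin 6 → Sgn
matchSign i j = if inM i j then minus else plus

mStar-product : ∀ i j α β → mStar (i , α) (j , β) ≡ α · β · matchSign i j
mStar-product i j α β with inM i j
mStar-product i j plus  plus  | t = refl
mStar-product i j plus  minus | true  = refl
mStar-product i j plus  minus | false = refl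
mStar-product i j minus plus  | true  = refl
mStar-product i j minus plus  | false = refl
mStar-product i j minus minus | true  = refl
mStar-product i j minus minus | false = refl

switch : Sgn → C → C
switch s (i , α) = (i , s · α)

record Edge (x : C) (e : Sgn) (y : C) : Set where
  constructor edge
  field
    adjacent : DSGAdj x y
    signed   : mStar x y ≡ e

mStar-switch : ∀ a b x y → mStar (switch a x) (switch b y) ≡ a · b · mStar x y
mStar-switch a b (i , α) (j , β) = begin
  mStar (i , a · α) (j , b · β)  ≡⟨ mStar-product i j (a · α) (b · β) ⟩
  a · α · (b · β) · μ            ≡⟨ cong (_· μ) (·-interchange a α b β) ⟩
  a · b · (α · β) · μ            ≡⟨ ·-assoc (a · b) (α · β) μ ⟩
  a · b · (α · β · μ)            ≡⟨ cong (a · b ·_) (sym (mStar-product i j α β)) ⟩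
  a · b · mStar (i , α) (j , β)  ∎
  where
  open ≡-Reasoning
  μ = matchSign i j

edge-switch : ∀ a b {x y e} → Edge x (a · b · e) y → Edge (switch a x) e (switch b y)
edge-switch a b {x} {y} {e} (edge adj sign) = edge adj (begin
  mStar (switch a x) (switch b y)  ≡⟨ mStar-switch a b x y ⟩
  a · b · mStar x y                ≡⟨ cong (a · b ·_) sign ⟩
  a · b · (a · b · e)              ≡⟨ sym (·-assoc (a · b) (a · b) e) ⟩
  a · b · (a · b) · e              ≡⟨ cong (_· e) (·-self (a · b)) ⟩
  e                                ∎)
  where open ≡-Reasoning

record Enumeration (A : Set) : Set where
  field
    elements : List A
    complete : ∀ x → x ∈ elements

open Enumeration ⦃ ... ⦄

instance
  enumerate-Sgn : Enumeration Sgn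
  enumerate-Sgn = record { elements = plus ∷ minus ∷ [] ; complete = λ { plus → here refl ; minus → there (here refl) } }

  enumerate-Bool : Enumeration Bool
  enumerate-Bool = record { elements = false ∷ true ∷ [] ; complete = λ { false → here refl ; true → there (here refl) } }

  enumerate-Fin : ∀ {n} → Enumeration (Fin n)
  enumerate-Fin = record { elements = allFin _ ; complete = ∈-allFin }

  enumerate-× : ∀ {A B : Set} → ⦃ Enumeration A ⦄ → ⦃ Enumeration B ⦄ → Enumeration (A × B)
  enumerate-× = record { elements = cartesianProduct elements elements
                       ; complete = λ (x , y) → ∈-cartesianProduct⁺ (complete x) (complete y) }

  enumerate-Vec : ∀ {A : Set} {n} → ⦃ Enumeration A ⦄ → Enumeration (Vec A n)
  enumerate-Vec {A} = record { elements = vectors _ ; complete = vectors-complete }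
    where
    vectors : ∀ n → List (Vec A n)
    vectors zero    = [] ∷ []
    vectors (suc n) = map (uncurry _∷_) (cartesianProduct elements (vectors n))
    vectors-complete : ∀ {n} (v : Vec A n) → v ∈ vectors n
    vectors-complete []       = here refl
    vectors-complete (a ∷ v) = ∈-map⁺ (uncurry _∷_) (∈-cartesianProduct⁺ (complete a) (vectors-complete v))

every : ∀ {A : Set} ⦃ _ : Enumeration A ⦄ (p : A → Bool) → T (all p elements) → ∀ x → T (p x)
every p h x = All.lookup (all⁺ p _ h) (complete x)

allOf : ∀ {A : Set} ⦃ _ : Enumeration A ⦄ (p : A → Bool) → (∀ x → T (p x)) → T (all p elements)
allOf p h = all⁻ p {elements} (All.tabulate (λ {x} _ → h x))

find : ∀ {A : Set} (p : A → Bool) (xs : List A) → T (any p xs) → Σ A (T ∘ p)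
find p xs h = satisfied (any⁻ p xs h)

implication : ∀ {a b} → T (not a ∨ b) → T a → T b
implication {true} hb _ = hb

∧-split : ∀ {a b} → T (a ∧ b) → T a × T b
∧-split {true} hb = tt , hb

∧-intro : ∀ {a b} → T a → T b → T (a ∧ b)
∧-intro {true} _ hb = hb

Layer : Set
Layer = Fin 3

inLayer : Layer → Bool → Fin 6
inLayer 0F false = 0F
inLayer 0F true  = 1F
inLayer 1F false = 2F
inLayer 1F true  = 3F
inLayer 2F false = 4F
inLayer 2F true  = 5F

_==ˡ_ : Layer → Layer → Bool
a ==ˡ b = ⌊ a ≟ᶠ b ⌋

isPlus : C → Bool
isPlus x = ⌊ sgn x ≟ₛ plus ⌋

edge-dec : ∀ x e y → Dec (Edge x e y)
edge-dec x e y = map′ (λ (a , s) → edge a s) (λ (edge a s) → a , s) (¬? (idx x ≟ᶠ idx y) ×-dec (mStar x y ≟ₛ e))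

edge? : C → Sgn → C → Bool
edge? x e y = ⌊ edge-dec x e y ⌋

edge-sound : ∀ {x e y} → T (edge? x e y) → Edge x e y
edge-sound = toWitness

matchSign-sym : ∀ i j → matchSign i j ≡ matchSign j i
matchSign-sym i j = toWitness (every (λ (i , j) → ⌊ matchSign i j ≟ₛ matchSign j i ⌋) tt (i , j))

edge-sym : ∀ {x e y} → Edge x e y → Edge y e x
edge-sym {i , α} {e} {j , β} (edge adj sign) = edge (adj ∘ sym) (begin
  mStar (j , β) (i , α)  ≡⟨ mStar-product j i β α ⟩
  β · α · matchSign j i  ≡⟨ cong₂ _·_ (·-comm β α) (matchSign-sym j i) ⟩
  α · β · matchSign i j  ≡⟨ sym (mStar-product i j α β) ⟩
  mStar (i , α) (j , β)  ≡⟨ sign ⟩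
  e                      ∎)
  where open ≡-Reasoning

-- The only colour of index j joined to x by an edge of sign e.
neighbour : C → Sgn → Fin 6 → C
neighbour (i , α) e j = j , α · e · matchSign i j

neighbour-edge : ∀ x e j → idx x ≢ j → Edge x e (neighbour x e j)
neighbour-edge (i , α) e j i≢j = edge i≢j (begin
  mStar (i , α) (j , α · e · μ)  ≡⟨ mStar-product i j α (α · e · μ) ⟩
  α · (α · e · μ) · μ            ≡⟨ cong (λ s → α · s · μ) (·-assoc α e μ) ⟩
  α · (α · (e · μ)) · μ          ≡⟨ cong (_· μ) (sym (·-assoc α α (e · μ))) ⟩
  α · α · (e · μ) · μ            ≡⟨ cong (λ s → s · (e · μ) · μ) (·-self α) ⟩
  e · μ · μ                      ≡⟨ ·-assoc e μ μ ⟩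
  e · (μ · μ)                    ≡⟨ cong (e ·_) (·-self μ) ⟩
  e · plus                       ≡⟨ ·-identityʳ e ⟩
  e                              ∎)
  where
  open ≡-Reasoning
  μ = matchSign i j

someNeighbour? : C → Sgn → (C → Bool) → Bool
someNeighbour? x e p = any (λ j → ⌊ ¬? (idx x ≟ᶠ j) ⌋ ∧ p (neighbour x e j)) elements

someNeighbour-sound : ∀ x e p → T (someNeighbour? x e p) → Σ C λ q → Edge x e q × T (p q)
someNeighbour-sound x e p h =
  let (j , found) = find (λ j → ⌊ ¬? (idx x ≟ᶠ j) ⌋ ∧ p (neighbour x e j)) elements h
      (fresh , pq) = ∧-split {⌊ ¬? (idx x ≟ᶠ j) ⌋} found
  in neighbour x e j , neighbour-edge x e j (toWitness fresh) , pq

-- The normal form of a neighbored 5-set: its two pairs are the positive halves of the layers other than c.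
Hub : Set
Hub = Layer × Bool

neighbored : Hub → SubC
neighbored (c , z) x = (not (layer x ==ˡ c) ∧ isPlus x) ∨ ⌊ x ≟ᶜ (inLayer c z , minus) ⌋

paired : Layer → SubC
paired m x = not (layer x ==ˡ m ∧ isPlus x)

balanced : Layer × Layer → SubC
balanced (a , b) x = not ((layer x ==ˡ a ∧ isPlus x) ∨ (layer x ==ˡ b ∧ not (isPlus x)))

everything : SubC
everything _ = true

representative : Hub → Layer → C
representative (c , z) l = if l ==ˡ c then (inLayer c z , minus) else (inLayer l false , plus)

representative-neighbored : ∀ h l → T (neighbored h (representative h l))
representative-neighbored h l = every (λ (h , l) → neighbored h (representative h l)) tt (h , l)

Bridge : SubC → C → Sgn → Sgn → C → Set
Bridge S x e e' y = Σ C λ p → T (S p) × Edge x e p × Edge p e' y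

bridge? : SubC → C → Sgn → Sgn → C → Bool
bridge? S x e e' y = someNeighbour? x e (λ p → S p ∧ edge? p e' y)

bridge-sound : ∀ S x e e' y → T (bridge? S x e e' y) → Bridge S x e e' y
bridge-sound S x e e' y h =
  let (p , xp , found) = someNeighbour-sound x e (λ p → S p ∧ edge? p e' y) h
      (sp , py) = ∧-split {S p} found
  in p , sp , xp , edge-sound py

fullBridge? : C → Sgn → Sgn → C → Bool
fullBridge? x e e' y = not (layer x ==ˡ layer y) ∨ ⌊ sgn x · e ≟ₛ sgn y · e' ⌋

full-bridge : ∀ x e e' y → T (fullBridge? x e e' y) → Bridge everything x e e' y
full-bridge x e e' y h = bridge-sound everything x e e' y (implication (every check tt (x , e , e' , y)) h)
  where
  check : C × Sgn × Sgn × C → Bool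
  check (x , e , e' , y) = not (fullBridge? x e e' y) ∨ bridge? everything x e e' y

-- If sgn x · e = sgn y · e' the middle colour can be taken in the third layer, unless that is the missing
-- positive half; otherwise the mate of x or of y works.
pairedBridge? : C → Sgn → Layer → Sgn → C → Bool
pairedBridge? x e m e' y =
  if layer x ==ˡ layer y then ⌊ sgn x · e ≟ₛ sgn y · e' ⌋
  else (not ⌊ sgn x · e ≟ₛ sgn y · e' ⌋ ∨ layer x ==ˡ m ∨ layer y ==ˡ m ∨ ⌊ sgn x · e ≟ₛ minus ⌋)

paired-bridge : ∀ x e m e' y → T (pairedBridge? x e m e' y) → Bridge (paired m) x e e' y
paired-bridge x e m e' y h = bridge-sound (paired m) x e e' y (implication (every check tt (x , e , m , e' , y)) h)
  where
  check : C × Sgn × Layer × Sgn × C → Bool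
  check (x , e , m , e' , y) = not (pairedBridge? x e m e' y) ∨ bridge? (paired m) x e e' y

_⊆[_]_ : SubC → Sgn → SubC → Set
S ⊆[ g ] L = ∀ x → T (S x) → switch g x ∈S L

filterᵇ-cong : ∀ {A : Set} {p q : A → Bool} → (∀ x → p x ≡ q x) → ∀ xs → filterᵇ p xs ≡ filterᵇ q xs
filterᵇ-cong p≗q []       = refl
filterᵇ-cong {p = p} {q} p≗q (x ∷ xs) with p x | q x | p≗q x
... | true  | .true  | refl = cong (x ∷_) (filterᵇ-cong p≗q xs)
... | false | .false | refl = filterᵇ-cong p≗q xs

Table : Set
Table = Vec (Bool × Bool) 6

fromTable : Table → SubC
fromTable t (i , plus)  = proj₁ (lookup t i)
fromTable t (i , minus) = proj₂ (lookup t i)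

toTable : SubC → Table
toTable L = tabulate (λ i → L (i , plus) , L (i , minus))

fromTable-toTable : ∀ L x → fromTable (toTable L) x ≡ L x
fromTable-toTable L (i , plus)  = cong proj₁ (lookup∘tabulate (λ i → L (i , plus) , L (i , minus)) i)
fromTable-toTable L (i , minus) = cong proj₂ (lookup∘tabulate (λ i → L (i , plus) , L (i , minus)) i)

countWhere-cong : ∀ (L L' P P' : SubC) → (∀ x → L x ∧ P x ≡ L' x ∧ P' x) → countWhere L P ≡ countWhere L' P'
countWhere-cong L L' P P' eq = cong length (filterᵇ-cong eq allC)

containedIn : SubC → Sgn → SubC → Bool
containedIn S g L = all (λ x → not (S x) ∨ L (switch g x)) elements

containedIn-sound : ∀ S g L → T (containedIn S g L) → S ⊆[ g ] L
containedIn-sound S g L h x sx = Equivalence.to T-≡ (implication (every (λ x → not (S x) ∨ L (switch g x)) h x) sx)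

-- Every list agrees pointwise with its table, so the checks over all 4096 tables apply to it.
module Tabulated (L : SubC) where
  L′ : SubC
  L′ = fromTable (toTable L)

  same : ∀ x → L′ x ≡ L x
  same = fromTable-toTable L

  sameCount : ∀ (P : SubC) → countWhere L′ P ≡ countWhere L P
  sameCount P = countWhere-cong L′ L P P (λ x → cong (_∧ P x) (same x))

  samePaired : countWhere L′ (λ x → not (L′ (pairOf x))) ≡ countWhere L (λ x → not (L (pairOf x)))
  samePaired = countWhere-cong L′ L (λ x → not (L′ (pairOf x))) (λ x → not (L (pairOf x))) (λ x → cong₂ (λ a b → a ∧ not b) (same x) (same (pairOf x)))

  back : ∀ {S g} → S ⊆[ g ] L′ → S ⊆[ g ] L
  back {S} {g} S⊆L′ x sx = trans (sym (same (switch g x))) (S⊆L′ x sx)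

isPairedSet? : ℕ → SubC → Bool
isPairedSet? n L = (countWhere L (λ x → not (L (pairOf x))) ≤ᵇ 1) ∧ (size L ≡ᵇ n)

paired10-check : ∀ t → T (not (isPairedSet? 10 (fromTable t)) ∨ any (λ (m , g) → containedIn (paired m) g (fromTable t)) elements)
paired10-check = every (λ t → not (isPairedSet? 10 (fromTable t)) ∨ any (λ (m , g) → containedIn (paired m) g (fromTable t)) elements) tt

paired10-normal : ∀ L → PairedSet 10 L → Σ (Layer × Sgn) λ (m , g) → paired m ⊆[ g ] L
paired10-normal L (pr , sz) =
  let ((m , g) , h) = find (λ (m , g) → containedIn (paired m) g L′) elements (implication (paired10-check (toTable L)) isPaired)
  in (m , g) , back {paired m} {g} (containedIn-sound (paired m) g L′ h)
  where
  open Tabulated L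
  isPaired : T (isPairedSet? 10 L′)
  isPaired = ∧-intro (≤⇒≤ᵇ (subst (_≤ 1) (sym samePaired) pr)) (≡⇒≡ᵇ _ _ (trans (sameCount (λ _ → true)) sz))

isBalanced? : SubC → Bool
isBalanced? L = isPairedSet? 8 L ∧ (countWhere L (λ x → sgn x ==S plus) ≡ᵇ 4) ∧ (countWhere L (λ x → sgn x ==S minus) ≡ᵇ 4)

balanced8-check : ∀ t → T (not (isBalanced? (fromTable t)) ∨ any (λ b → containedIn (balanced b) plus (fromTable t)) elements)
balanced8-check = every (λ t → not (isBalanced? (fromTable t)) ∨ any (λ b → containedIn (balanced b) plus (fromTable t)) elements) tt

balanced8-normal : ∀ L → BalancedPaired8 L → Σ (Layer × Layer) λ b → balanced b ⊆[ plus ] L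
balanced8-normal L ((pr , sz) , pl , mi) =
  let (b , h) = find (λ b → containedIn (balanced b) plus L′) elements (implication (balanced8-check (toTable L)) isBalanced)
  in b , back {balanced b} {plus} (containedIn-sound (balanced b) plus L′ h)
  where
  open Tabulated L
  isBalanced : T (isBalanced? L′)
  isBalanced = ∧-intro (∧-intro (≤⇒≤ᵇ (subst (_≤ 1) (sym samePaired) pr)) (≡⇒≡ᵇ _ _ (trans (sameCount (λ _ → true)) sz)))
                    (∧-intro (≡⇒≡ᵇ _ _ (trans (sameCount _) pl)) (≡⇒≡ᵇ _ _ (trans (sameCount _) mi)))

open import Data.List.Membership.DecPropositional _≟ᶜ_ using (_∈?_)

fiveList : C → C → C → List C
fiveList x y z = x ∷ pairOf x ∷ y ∷ pairOf y ∷ z ∷ []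

five : C → C → C → SubC
five x y z c = ⌊ c ∈? fiveList x y z ⌋

noThree? : SubC → Bool
noThree? K = all (λ l → countWhere K (λ x → ⌊ layer x ≟ᶠ l ⌋) ≤ᵇ 2) elements

neighbored5-check : ∀ ((α , i , j , l) : Sgn × Fin 6 × Fin 6 × Fin 6) →
  let K = five (i , α) (j , α) (l , opp α) in
  T (not ((size K ≡ᵇ 5) ∧ noThree? K) ∨ any (λ (h , g) → containedIn (neighbored h) g K) elements)
neighbored5-check = every (λ (α , i , j , l) → let K = five (i , α) (j , α) (l , opp α) in
  not ((size K ≡ᵇ 5) ∧ noThree? K) ∨ any (λ (h , g) → containedIn (neighbored h) g K) elements) tt

FiveOf : C → C → C → C → Set
FiveOf x y z c = (c ≡ x) ⊎ (c ≡ pairOf x) ⊎ (c ≡ y) ⊎ (c ≡ pairOf y) ⊎ (c ≡ z)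

fiveOf-∈ : ∀ {x y z c} → FiveOf x y z c → c ∈ fiveList x y z
fiveOf-∈ (inj₁ e)                      = here e
fiveOf-∈ (inj₂ (inj₁ e))               = there (here e)
fiveOf-∈ (inj₂ (inj₂ (inj₁ e)))        = there (there (here e))
fiveOf-∈ (inj₂ (inj₂ (inj₂ (inj₁ e)))) = there (there (there (here e)))
fiveOf-∈ (inj₂ (inj₂ (inj₂ (inj₂ e)))) = there (there (there (there (here e))))

∈-fiveOf : ∀ {x y z c} → c ∈ fiveList x y z → FiveOf x y z c
∈-fiveOf (here e)                             = inj₁ e
∈-fiveOf (there (here e))                     = inj₂ (inj₁ e)
∈-fiveOf (there (there (here e)))             = inj₂ (inj₂ (inj₁ e))
∈-fiveOf (there (there (there (here e))))     = inj₂ (inj₂ (inj₂ (inj₁ e)))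
∈-fiveOf (there (there (there (there (here e))))) = inj₂ (inj₂ (inj₂ (inj₂ e)))

neighbored5-normal : ∀ L → Neighbored5 L → Σ (Hub × Sgn) λ (h , g) → neighbored h ⊆[ g ] L
neighbored5-normal L (sz , nt , α , (i , .α) , (j , .α) , (l , .(opp α)) , refl , refl , refl , exh , mx , mpx , my , mpy , mz) =
  let ((h , g) , hg) = find (λ (h , g) → containedIn (neighbored h) g K) elements
                            (implication (neighbored5-check (α , i , j , l)) (∧-intro size5 (allOf _ noThree)))
  in (h , g) , λ c hc → trans (same (switch g c)) (containedIn-sound (neighbored h) g K hg c hc)
  where
  x = (i , α)
  y = (j , α)
  z = (l , opp α)
  K = five x y z
  listed : ∀ c → FiveOf x y z c → c ∈S L
  listed c (inj₁ refl)                      = mx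
  listed c (inj₂ (inj₁ refl))               = mpx
  listed c (inj₂ (inj₂ (inj₁ refl)))        = my
  listed c (inj₂ (inj₂ (inj₂ (inj₁ refl)))) = mpy
  listed c (inj₂ (inj₂ (inj₂ (inj₂ refl)))) = mz
  same : ∀ c → L c ≡ K c
  same c with L c in e
  ... | true  = sym (Equivalence.to T-≡ (fromWitness (fiveOf-∈ (exh c e))))
  ... | false with K c in e′
  ...   | false = refl
  ...   | true  = trans (sym e) (listed c (∈-fiveOf (toWitness (Equivalence.from T-≡ e′))))
  size5 : T (size K ≡ᵇ 5)
  size5 = ≡⇒≡ᵇ _ _ (trans (countWhere-cong K L _ _ (λ c → cong (_∧ true) (sym (same c)))) sz)
  noThree : ∀ m → T (countWhere K (λ c → ⌊ layer c ≟ᶠ m ⌋) ≤ᵇ 2)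
  noThree m = ≤⇒≤ᵇ (subst (_≤ 2) (countWhere-cong L K _ _ (λ c → cong (_∧ _) (same c))) (nt m))

data Kind : Set where
  neighboredKind pairedKind balancedKind fullKind : Kind

KindHyp : Kind → SubC → Set
KindHyp neighboredKind L = Neighbored5 L
KindHyp pairedKind     L = PairedSet 10 L
KindHyp balancedKind   L = BalancedPaired8 L
KindHyp fullKind       L = Full L

Params : Kind → Set
Params neighboredKind = Hub
Params pairedKind     = Layer
Params balancedKind   = Layer × Layer
Params fullKind       = ⊤

setOf : (K : Kind) → Params K → SubC
setOf neighboredKind h = neighbored h
setOf pairedKind     m = paired m
setOf balancedKind   b = balanced b
setOf fullKind       _ = everything

normalise : ∀ K L → KindHyp K L → Σ (Params K × Sgn) λ (p , g) → setOf K p ⊆[ g ] L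
normalise neighboredKind L hyp = neighbored5-normal L hyp
normalise pairedKind     L hyp = paired10-normal L hyp
normalise balancedKind   L hyp = let (b , h) = balanced8-normal L hyp in (b , plus) , h
normalise fullKind       L hyp = (tt , plus) , λ x _ → hyp (switch plus x)

default : (K : Kind) → Params K
default neighboredKind = 0F , false
default pairedKind     = 0F
default balancedKind   = 0F , 0F
default fullKind       = tt

readAs : ∀ K K′ → Params K → Params K′
readAs neighboredKind neighboredKind p = p
readAs pairedKind     pairedKind     p = p
readAs balancedKind   balancedKind   p = p
readAs fullKind       fullKind       p = p
readAs _              K′             _ = default K′

readAs-same : ∀ K p → readAs K K p ≡ p
readAs-same neighboredKind p = refl
readAs-same pairedKind     p = refl
readAs-same balancedKind   p = refl
readAs-same fullKind       p = refl

Rel : ℕ → Set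
Rel n = Fin n → Fin n → Bool

indicator : Bool → ℕ
indicator false = 0
indicator true  = 1

count : ∀ {n} → Rel n → ℕ
count {n} R = ∑[ a < n ] ∑[ b < n ] indicator (R a b)

sum-mono-≤ : ∀ {n} {f g : Fin n → ℕ} → (∀ i → f i ≤ g i) → sum f ≤ sum g
sum-mono-≤ {zero}  f≤g = z≤n
sum-mono-≤ {suc n} f≤g = +-mono-≤ (f≤g zero) (sum-mono-≤ (f≤g ∘ suc))

sum-const : ∀ n c → ∑[ i < n ] c ≡ n * c
sum-const zero    c = refl
sum-const (suc n) c = cong (c +_) (sum-const n c)

count-transpose-permute : ∀ {n} (π : Permutation′ n) (R : Rel n) →
  count (λ a b → R (π ⟨$⟩ʳ b) a) ≡ count R
count-transpose-permute {n} π R = begin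
  ∑[ a < n ] ∑[ b < n ] indicator (R (π ⟨$⟩ʳ b) a)  ≡⟨ ∑-comm (λ a b → indicator (R (π ⟨$⟩ʳ b) a)) ⟩
  ∑[ b < n ] ∑[ a < n ] indicator (R (π ⟨$⟩ʳ b) a)  ≡⟨ sym (sum-permute (λ c → ∑[ a < n ] indicator (R c a)) π) ⟩
  ∑[ c < n ] ∑[ a < n ] indicator (R c a)            ∎
  where open ≡-Reasoning

pigeonhole : ∀ {n} (R S : Rel n) → n * n < count R + count S → ∃₂ λ a b → T (R a b) × T (S a b)
pigeonhole {n} R S large with any? (λ a → any? (λ b → T? (R a b ∧ S a b)))
... | yes (a , b , both) = a , b , ∧-split both
... | no disjoint = contradiction small (<⇒≱ large)
  where
  r s : Fin n → Fin n → ℕ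
  r a b = indicator (R a b)
  s a b = indicator (S a b)
  cell : ∀ a b → r a b + s a b ≤ 1
  cell a b with R a b in ra | S a b in sa
  ... | false | false = z≤n
  ... | false | true  = ≤-refl
  ... | true  | false = ≤-refl
  ... | true  | true  = contradiction (a , b , subst T (sym (cong₂ _∧_ ra sa)) tt) disjoint
  small : count R + count S ≤ n * n
  small = begin
    count R + count S                                    ≡⟨ sym (∑-distrib-+ (λ a → ∑[ b < n ] r a b) (λ a → ∑[ b < n ] s a b)) ⟩
    ∑[ a < n ] (∑[ b < n ] r a b + ∑[ b < n ] s a b)     ≡⟨ sum-cong-≗ {n} (λ a → sym (∑-distrib-+ (r a) (s a))) ⟩
    ∑[ a < n ] ∑[ b < n ] (r a b + s a b)                ≤⟨ sum-mono-≤ {n} (λ a → sum-mono-≤ {n} (cell a)) ⟩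
    ∑[ a < n ] ∑[ b < n ] 1                              ≡⟨ sum-cong-≗ {n} (λ a → sum-const n 1) ⟩
    ∑[ a < n ] (n * 1)                                   ≡⟨ sum-const n (n * 1) ⟩
    n * (n * 1)                                          ≡⟨ cong (n *_) (*-identityʳ n) ⟩
    n * n                                                ∎
    where open ≤-Reasoning

closed-route : ∀ {n} (R B : Rel n) (π : Permutation′ n) → n * n < count R + count B →
  ∃₂ λ a b → T (R a b) × T (B (π ⟨$⟩ʳ b) a)
closed-route R B π large =
  pigeonhole R (λ a b → B (π ⟨$⟩ʳ b) a) (subst (λ c → _ < count R + c) (sym (count-transpose-permute π B)) large)

involution : (f : Fin 3 → Fin 3) → (∀ x → f (f x) ≡ x) → Permutation′ 3
involution f inv = permutation f f inv inv

rotation : Permutation′ 3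
rotation = permutation (λ { 0F → 1F ; 1F → 2F ; 2F → 0F }) (λ { 0F → 2F ; 1F → 0F ; 2F → 1F })
  (λ { 0F → refl ; 1F → refl ; 2F → refl }) (λ { 0F → refl ; 1F → refl ; 2F → refl })

permutations3 : List (Permutation′ 3)
permutations3 =
  idₚ ∷ rotation ∷ flip rotation
  ∷ involution (λ { 0F → 1F ; 1F → 0F ; 2F → 2F }) (λ { 0F → refl ; 1F → refl ; 2F → refl })
  ∷ involution (λ { 0F → 2F ; 1F → 1F ; 2F → 0F }) (λ { 0F → refl ; 1F → refl ; 2F → refl })
  ∷ involution (λ { 0F → 0F ; 1F → 2F ; 2F → 1F }) (λ { 0F → refl ; 1F → refl ; 2F → refl }) ∷ []

containsGraph : Rel 3 → Permutation′ 3 → Bool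
containsGraph R π = all (λ l → R l (π ⟨$⟩ʳ l)) elements

atLeast : ℕ → Rel 3 → Bool
atLeast k R = k ≤ᵇ count R

viaPaired : Hub → Sgn → Layer → Sgn → Hub → Rel 3
viaPaired h e m e' h' l l' = pairedBridge? (representative h l) e m e' (representative h' l')

viaPaired-sound : ∀ h e m e' h' l l' → T (viaPaired h e m e' h' l l') →
  Bridge (paired m) (representative h l) e e' (representative h' l')
viaPaired-sound h e m e' h' l l' = paired-bridge (representative h l) e m e' (representative h' l')

viaPaired-hasPermutation : ∀ h e m e' h' → T (any (containsGraph (viaPaired h e m e' h')) permutations3)
viaPaired-hasPermutation h e m e' h' =
  every (λ (h , e , m , e' , h') → any (containsGraph (viaPaired h e m e' h')) permutations3) tt (h , e , m , e' , h')

viaPaired-permutation : ∀ h e m e' h' → Σ (Permutation′ 3) λ π → ∀ l → T (viaPaired h e m e' h' l (π ⟨$⟩ʳ l))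
viaPaired-permutation h e m e' h' =
  let (π , graph) = find (containsGraph (viaPaired h e m e' h')) permutations3 (viaPaired-hasPermutation h e m e' h')
  in π , every (λ l → viaPaired h e m e' h' l (π ⟨$⟩ʳ l)) graph

viaPaired-count : ∀ h e m e' h' → 5 ≤ count (viaPaired h e m e' h')
viaPaired-count h e m e' h' =
  ≤ᵇ⇒≤ 5 _ (every (λ (h , e , m , e' , h') → atLeast 5 (viaPaired h e m e' h')) tt (h , e , m , e' , h'))

viaBalancedPaired : Hub → Sgn → Layer × Layer → Sgn → Layer → Sgn → Hub → Rel 3
viaBalancedPaired h e b e' m e'' h' l l' =
  someNeighbour? (representative h l) e (λ q → balanced b q ∧ pairedBridge? q e' m e'' (representative h' l'))

viaBalancedPaired-sound : ∀ h e b e' m e'' h' l l' → T (viaBalancedPaired h e b e' m e'' h' l l') →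
  Σ C λ q → T (balanced b q) × Edge (representative h l) e q × Bridge (paired m) q e' e'' (representative h' l')
viaBalancedPaired-sound h e b e' m e'' h' l l' holds =
  let (q , hq , found) = someNeighbour-sound _ e (λ q → balanced b q ∧ pairedBridge? q e' m e'' (representative h' l')) holds
      (q∈ , bridged) = ∧-split {balanced b q} found
  in q , q∈ , hq , paired-bridge _ _ _ _ _ bridged

viaBalancedPaired-count : ∀ h e b e' m e'' h' → 6 ≤ count (viaBalancedPaired h e b e' m e'' h')
viaBalancedPaired-count h e b e' m e'' h' =
  ≤ᵇ⇒≤ 6 _ (every (λ (h , e , b , e' , m , e'' , h') → atLeast 6 (viaBalancedPaired h e b e' m e'' h')) tt
                  (h , e , b , e' , m , e'' , h'))

viaFullBalanced : Hub → Sgn → Sgn → Layer × Layer → Sgn → Hub → Rel 3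
viaFullBalanced h e e' b e'' h' l l' =
  someNeighbour? (representative h' l') e'' (λ q → balanced b q ∧ fullBridge? (representative h l) e e' q)

viaFullBalanced-sound : ∀ h e e' b e'' h' l l' → T (viaFullBalanced h e e' b e'' h' l l') →
  Σ C λ q → T (balanced b q) × Bridge everything (representative h l) e e' q × Edge q e'' (representative h' l')
viaFullBalanced-sound h e e' b e'' h' l l' holds =
  let (q , h'q , found) = someNeighbour-sound _ e'' (λ q → balanced b q ∧ fullBridge? (representative h l) e e' q) holds
      (q∈ , bridged) = ∧-split {balanced b q} found
  in q , q∈ , full-bridge _ _ _ _ bridged , edge-sym h'q

viaFullBalanced-count : ∀ h e e' b e'' h' → 8 ≤ count (viaFullBalanced h e e' b e'' h')
viaFullBalanced-count h e e' b e'' h' =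
  ≤ᵇ⇒≤ 8 _ (every (λ (h , e , e' , b , e'' , h') → atLeast 8 (viaFullBalanced h e e' b e'' h')) tt (h , e , e' , b , e'' , h'))

adjacent : Hub → Sgn → Hub → Rel 3
adjacent h e h' l l' = edge? (representative h l) e (representative h' l')

adjacent-count : ∀ h e h' → 2 ≤ count (adjacent h e h')
adjacent-count h e h' = ≤ᵇ⇒≤ 2 _ (every (λ (h , e , h') → atLeast 2 (adjacent h e h')) tt (h , e , h'))

viaNeighboredFull : Hub → Sgn → Hub → Sgn → Sgn → Hub → Rel 3
viaNeighboredFull h e n e' e'' h' l l' =
  someNeighbour? (representative h l) e (λ y → neighbored n y ∧ fullBridge? y e' e'' (representative h' l'))

viaNeighboredFull-sound : ∀ h e n e' e'' h' l l' → T (viaNeighboredFull h e n e' e'' h' l l') →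
  Σ C λ y → T (neighbored n y) × Edge (representative h l) e y × Bridge everything y e' e'' (representative h' l')
viaNeighboredFull-sound h e n e' e'' h' l l' holds =
  let (y , hy , found) = someNeighbour-sound _ e (λ y → neighbored n y ∧ fullBridge? y e' e'' (representative h' l')) holds
      (y∈ , bridged) = ∧-split {neighbored n y} found
  in y , y∈ , hy , full-bridge _ _ _ _ bridged

viaNeighboredFull-count : ∀ h e n e' e'' h' → 4 ≤ count (viaNeighboredFull h e n e' e'' h')
viaNeighboredFull-count h e n e' e'' h' =
  ≤ᵇ⇒≤ 4 _ (every (λ (h , e , n , e' , e'' , h') → atLeast 4 (viaNeighboredFull h e n e' e'' h')) tt (h , e , n , e' , e'' , h'))

viaBalanced : Hub → Sgn → Layer × Layer → Sgn → Hub → Rel 3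
viaBalanced h e b e' h' l l' = bridge? (balanced b) (representative h l) e e' (representative h' l')

viaFull : Hub → Sgn → Sgn → Hub → Rel 3
viaFull h e e' h' l l' = fullBridge? (representative h l) e e' (representative h' l')

closesSquare : Hub → Sgn → Layer × Layer → Sgn → Hub → Sgn → Sgn → Bool
closesSquare h e b e' h' e'' e''' = any (λ ((l , l') : Layer × Layer) → viaBalanced h e b e' h' l l' ∧ viaFull h' e'' e''' h l' l) elements

square-check : ∀ h e b e' h' e'' e''' → T (closesSquare h e b e' h' e'' e''')
square-check h e b e' h' e'' e''' =
  every (λ (h , e , b , e' , h' , e'' , e''') → closesSquare h e b e' h' e'' e''') tt (h , e , b , e' , h' , e'' , e''')

square-closes : ∀ h e b e' h' e'' e''' → Σ (Layer × Layer) λ (l , l') →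
  Bridge (balanced b) (representative h l) e e' (representative h' l') × Bridge everything (representative h' l') e'' e''' (representative h l)
square-closes h e b e' h' e'' e''' =
  let ((l , l') , both) = find (λ ((l , l') : Layer × Layer) → viaBalanced h e b e' h' l l' ∧ viaFull h' e'' e''' h l' l) elements
                               (square-check h e b e' h' e'' e''')
      (outward , homeward) = ∧-split {viaBalanced h e b e' h' l l'} both
  in (l , l') , bridge-sound (balanced b) _ e e' _ outward , full-bridge _ e'' e''' _ homeward

Step : (ℕ → Sgn) → (ℕ → SubC) → ℕ → C → C → Set
Step ε S t x y = Edge x (ε t) y × y ∈S S (suc t)

infixr 5 _∷_

data Walk (ε : ℕ → Sgn) (S : ℕ → SubC) : ℕ → C → ℕ → C → Set where
  []  : ∀ {t x} → Walk ε S t x t x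
  _∷_ : ∀ {t x y u z} → Step ε S t x y → Walk ε S (suc t) y u z → Walk ε S t x u z

module _ {ε : ℕ → Sgn} {S : ℕ → SubC} where

  infixr 5 _++_

  _++_ : ∀ {s x t y u z} → Walk ε S s x t y → Walk ε S t y u z → Walk ε S s x u z
  []       ++ w′ = w′
  (st ∷ w) ++ w′ = st ∷ (w ++ w′)

  walk-≤ : ∀ {s x u z} → Walk ε S s x u z → s ≤ u
  walk-≤ []      = ≤-refl
  walk-≤ (_ ∷ w) = ≤-trans (n≤1+n _) (walk-≤ w)

  colour : ∀ {s x u z} → Walk ε S s x u z → ℕ → C
  colour {x = x} []                 t = x
  colour {s = s} {x = x} (_ ∷ w) t with t ≤? s
  ... | yes _ = x
  ... | no  _ = colour w t

  colour-start : ∀ {s x u z} (w : Walk ε S s x u z) → colour w s ≡ x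
  colour-start         []      = refl
  colour-start {s = s} (_ ∷ w) with s ≤? s
  ... | yes _   = refl
  ... | no  s≰s = contradiction ≤-refl s≰s

  colour-later : ∀ {s x y u z} (st : Step ε S s x y) (w : Walk ε S (suc s) y u z) t → s < t → colour (st ∷ w) t ≡ colour w t
  colour-later {s = s} st w t s<t with t ≤? s
  ... | yes t≤s = contradiction t≤s (<⇒≱ s<t)
  ... | no  _   = refl

  colour-end : ∀ {s x u z} (w : Walk ε S s x u z) → colour w u ≡ z
  colour-end         []       = refl
  colour-end {u = u} (st ∷ w) = trans (colour-later st w u (walk-≤ w)) (colour-end w)

  colour-step : ∀ {s x u z} (w : Walk ε S s x u z) t → s ≤ t → t < u → Step ε S t (colour w t) (colour w (suc t))
  colour-step []       t s≤t t<s = contradiction s≤t (<⇒≱ t<s)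
  colour-step {s = s} (st ∷ w) t s≤t t<u with m≤n⇒m<n∨m≡n s≤t
  ... | inj₂ refl = subst₂ (Step ε S s) (sym (colour-start (st ∷ w)))
                      (sym (trans (colour-later st w (suc s) (n<1+n s)) (colour-start w))) st
  ... | inj₁ s<t  = subst₂ (Step ε S t) (sym (colour-later st w t s<t))
                      (sym (colour-later st w (suc t) (m<n⇒m<1+n s<t))) (colour-step w t s<t t<u)

switch-walk : ∀ {ε S} (g : ℕ → Sgn) {s x u y} →
  Walk (λ t → g t · g (suc t) · ε t) (λ t x → S t (switch (g t) x)) s x u y →
  Walk ε S s (switch (g s) x) u (switch (g u) y)
switch-walk g []             = []
switch-walk g ((e , m) ∷ w) = (edge-switch (g _) (g _) e , m) ∷ switch-walk g w

module Cyclic (n : ℕ) ⦃ _ : NonZero n ⦄ where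

  at : ∀ {A : Set} → (Fin n → A) → ℕ → A
  at f t = f (t mod n)

  toℕ-mod : ∀ (i : Fin n) → toℕ i mod n ≡ i
  toℕ-mod i = toℕ-injective (trans (toℕ-fromℕ< (m%n<n (toℕ i) n)) (m<n⇒m%n≡m (toℕ<n i)))

  n-mod : n mod n ≡ 0 mod n
  n-mod = toℕ-injective (trans (toℕ-fromℕ< (m%n<n n n)) (trans ([m+n]%n≡m%n 0 n) (sym (toℕ-fromℕ< (m%n<n 0 n)))))

  closed-walk-colourable : ∀ σ L {x} → Walk (at σ) (at L) 0 x n x → x ∈S at L 0 → LColorable n σ L
  closed-walk-colourable σ L {x} w x∈L = φ , listed , edges
    where
    φ : Fin n → C
    φ i = colour w (toℕ i)
    step : ∀ t → t < n → Step (at σ) (at L) t (colour w t) (colour w (suc t))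
    step t t<n = colour-step w t z≤n t<n
    listed : ∀ i → φ i ∈S L i
    listed i with toℕ i in eq
    ... | zero  = subst (λ j → colour w zero ∈S L j) (trans (cong (_mod n) (sym eq)) (toℕ-mod i))
                    (subst (_∈S at L 0) (sym (colour-start w)) x∈L)
    ... | suc t = subst (λ j → colour w (suc t) ∈S L j) (trans (cong (_mod n) (sym eq)) (toℕ-mod i))
                    (proj₂ (step t (≤-trans (n≤1+n (suc t)) (subst (_< n) eq (toℕ<n i)))))
    edgeTo : ∀ i j → colour w (suc (toℕ i)) ≡ φ j → DSGAdj (φ i) (φ j) × mStar (φ i) (φ j) ≡ σ i
    edgeTo i j next with proj₁ (step (toℕ i) (toℕ<n i))
    ... | edge adjacent signed = subst (λ y → DSGAdj (φ i) y × mStar (φ i) y ≡ σ i) next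
                                   (adjacent , trans signed (cong σ (toℕ-mod i)))
    edges : ∀ i j → CycEdge n i j → DSGAdj (φ i) (φ j) × mStar (φ i) (φ j) ≡ σ i
    edges i j (inj₁ next)           = edgeTo i j (cong (colour w) next)
    edges i j (inj₂ (last , first)) =
      edgeTo i j (trans (cong (colour w) last) (trans (colour-end w) (trans (sym (colour-start w)) (cong (colour w) (sym first)))))

ladder : ℕ → ℕ → ℕ
ladder s zero    = s
ladder s (suc h) = suc (suc (ladder s h))

module Segments (ε : ℕ → Sgn) (S : ℕ → SubC) where

  _⊆at_ : SubC → ℕ → Set
  A ⊆at t = ∀ y → T (A y) → y ∈S S t

  edge-walk : ∀ {t x y A} → Edge x (ε t) y → A ⊆at suc t → T (A y) → Walk ε S t x (suc t) y
  edge-walk xy A⊆ ay = (xy , A⊆ _ ay) ∷ []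

  bridge-walk : ∀ {t x y A B} → Bridge A x (ε t) (ε (suc t)) y → A ⊆at suc t → B ⊆at suc (suc t) → T (B y) →
                Walk ε S t x (suc (suc t)) y
  bridge-walk (p , ap , xp , py) A⊆ B⊆ by = (xp , A⊆ p ap) ∷ (py , B⊆ _ by) ∷ []

  -- Hubs at start, start + 2, … joined through paired lists; every hop permutes the layers.
  module Chain (start : ℕ) (hub : ℕ → Hub) (gap : ℕ → Layer) where

    position : ℕ → ℕ
    position = ladder start

    hopping : ∀ h → Σ (Permutation′ 3) λ π → ∀ l →
              T (viaPaired (hub h) (ε (position h)) (gap h) (ε (suc (position h))) (hub (suc h)) l (π ⟨$⟩ʳ l))
    hopping h = viaPaired-permutation (hub h) (ε (position h)) (gap h) (ε (suc (position h))) (hub (suc h))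

    hop : ℕ → Permutation′ 3
    hop h = proj₁ (hopping h)

    route : ℕ → Permutation′ 3
    route zero    = idₚ
    route (suc r) = route r ∘ₚ hop r

    chain-walk : ∀ r → (∀ h → h ≤ r → neighbored (hub h) ⊆at position h) → (∀ h → h < r → paired (gap h) ⊆at suc (position h)) →
                 ∀ l → Walk ε S start (representative (hub 0) l) (position r) (representative (hub r) (route r ⟨$⟩ʳ l))
    chain-walk zero    hubs gaps l = []
    chain-walk (suc r) hubs gaps l =
      chain-walk r (λ h h≤r → hubs h (m≤n⇒m≤1+n h≤r)) (λ h h<r → gaps h (m<n⇒m<1+n h<r)) l ++
      bridge-walk (viaPaired-sound (hub r) (ε (position r)) (gap r) (ε (suc (position r))) (hub (suc r)) l′ (hop r ⟨$⟩ʳ l′)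
                                   (proj₂ (hopping r) l′))
                  (gaps r (n<1+n r)) (hubs (suc r) ≤-refl) (representative-neighbored (hub (suc r)) (hop r ⟨$⟩ʳ l′))
      where l′ = route r ⟨$⟩ʳ l

-- kind is indexed by the paper's position pos i = toℕ i + 1, so the list at position t on ℕ has kind kind (suc t).
module Normalised (n : ℕ) ⦃ _ : NonZero n ⦄ (σ : Fin n → Sgn) (L : Fin n → SubC)
                  (kind : ℕ → Kind) (hyp : ∀ i → KindHyp (kind (pos i)) (L i)) where
  open Cyclic n

  normalForm : ∀ i → Σ (Params (kind (pos i)) × Sgn) λ (p , g) → setOf (kind (pos i)) p ⊆[ g ] L i
  normalForm i = normalise (kind (pos i)) (L i) (hyp i)

  switching : ℕ → Sgn
  switching = at (λ i → proj₂ (proj₁ (normalForm i)))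

  signs : ℕ → Sgn
  signs t = switching t · switching (suc t) · at σ t

  lists : ℕ → SubC
  lists t y = at L t (switch (switching t) y)

  open Segments signs lists public

  -- Junk unless the list at position t has kind K.
  paramsAt : (K : Kind) → ℕ → Params K
  paramsAt K t = readAs (kind (pos (t mod n))) K (proj₁ (proj₁ (normalForm (t mod n))))

  paramsAt-fits : ∀ K t → t < n → kind (suc t) ≡ K → setOf K (paramsAt K t) ⊆at t
  paramsAt-fits K t t<n eq = fromFin (t mod n) (trans (cong (kind ∘ suc) toℕ-t) eq)
    where
    toℕ-t : toℕ (t mod n) ≡ t
    toℕ-t = trans (toℕ-fromℕ< (m%n<n t n)) (m<n⇒m%n≡m t<n)
    fromFin : ∀ {K} i → (eq : kind (pos i) ≡ K) →
              setOf K (readAs (kind (pos i)) K (proj₁ (proj₁ (normalForm i)))) ⊆[ proj₂ (proj₁ (normalForm i)) ] L i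
    fromFin i refl = subst (λ p → setOf (kind (pos i)) p ⊆[ proj₂ (proj₁ (normalForm i)) ] L i)
                           (sym (readAs-same (kind (pos i)) (proj₁ (proj₁ (normalForm i))))) (proj₂ (normalForm i))

  wrap : ∀ {A} → A ⊆at 0 → A ⊆at n
  wrap {A} A⊆ = subst (λ i → ∀ y → T (A y) → switch (proj₂ (proj₁ (normalForm i))) y ∈S L i) (sym n-mod) A⊆

  colourable : ∀ {x} → Walk signs lists 0 x n x → x ∈S lists 0 → LColorable n σ L
  colourable {x} w x∈ = closed-walk-colourable σ L
    (subst (λ g → Walk (at σ) (at L) 0 (switch (switching 0) x) n (switch g x))
           (cong (λ i → proj₂ (proj₁ (normalForm i))) n-mod) (switch-walk switching w))
    x∈

isEven? : ℕ → Bool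
isEven? p = p % 2 ≡ᵇ 0

%2-suc-suc : ∀ m → suc (suc m) % 2 ≡ m % 2
%2-suc-suc m = trans (cong (_% 2) (+-comm 2 m)) ([m+n]%n≡m%n m 2)

parity : ∀ m → (m % 2 ≡ 0) ⊎ (m % 2 ≡ 1)
parity zero          = inj₁ refl
parity (suc zero)    = inj₂ refl
parity (suc (suc m)) rewrite %2-suc-suc m = parity m

ladder-suc : ∀ s h → suc (ladder s h) ≡ ladder (suc s) h
ladder-suc s zero    = refl
ladder-suc s (suc h) = cong (λ m → suc (suc m)) (ladder-suc s h)

ladder-parity : ∀ s h → ladder s h % 2 ≡ s % 2
ladder-parity s zero    = refl
ladder-parity s (suc h) = trans (%2-suc-suc (ladder s h)) (ladder-parity s h)

ladder-≡ : ∀ s h → ladder s h ≡ s + 2 * h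
ladder-≡ s zero    = sym (+-identityʳ s)
ladder-≡ s (suc h) = trans (cong (λ m → suc (suc m)) (ladder-≡ s h)) (step s h)
  where
  step : ∀ s h → suc (suc (s + 2 * h)) ≡ s + 2 * suc h
  step = solve-∀

ladder-mono : ∀ s {h r} → h ≤ r → ladder s h ≤ ladder s r
ladder-mono s {h} {r} h≤r = subst₂ _≤_ (sym (ladder-≡ s h)) (sym (ladder-≡ s r)) (+-monoʳ-≤ s (*-monoʳ-≤ 2 h≤r))

ladder-≥ : ∀ s h → s ≤ ladder s h
ladder-≥ s h = subst (s ≤_) (sym (ladder-≡ s h)) (m≤m+n s (2 * h))

≡ᵇ-false : ∀ {m k} → m ≢ k → (m ≡ᵇ k) ≡ false
≡ᵇ-false {m} {k} m≢k with m ≡ᵇ k in e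
... | true  = contradiction (≡ᵇ⇒≡ m k (subst T (sym e) tt)) m≢k
... | false = refl

≡ᵇ-refl : ∀ m → (m ≡ᵇ m) ≡ true
≡ᵇ-refl zero    = refl
≡ᵇ-refl (suc m) = ≡ᵇ-refl m

≡ᵇ-false⇒≢ : ∀ {m k} → (m ≡ᵇ k) ≡ false → m ≢ k
≡ᵇ-false⇒≢ {m} e refl = contradiction (trans (sym (≡ᵇ-refl m)) e) (λ ())

-- Positions are counted from 0. The hubs are the odd positions, the even ones are paired 10-sets; R joins the
-- hubs at 1 and 3, the chain runs from 3 to n - 1, and B closes from n - 1 through position 0 back to 1.
module Case1 (k′ : ℕ) (σ : Fin (2 * suc (suc k′)) → Sgn) (L : Fin (2 * suc (suc k′)) → SubC)
             (cond : Cond1 (suc (suc k′)) L) where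

  n : ℕ
  n = 2 * suc (suc k′)

  kind : ℕ → Kind
  kind p = if isEven? p then neighboredKind else pairedKind

  hyp : ∀ i → KindHyp (kind (pos i)) (L i)
  hyp i with parity (pos i)
  ... | inj₁ even rewrite even = proj₁ (cond i) even
  ... | inj₂ odd  rewrite odd  = proj₂ (cond i) odd

  open Normalised n σ L kind hyp

  hub : ℕ → Hub
  hub = paramsAt neighboredKind

  gap : ℕ → Layer
  gap = paramsAt pairedKind

  open Chain 3 (hub ∘ ladder 3) (gap ∘ suc ∘ ladder 3)

  last : ℕ
  last = ladder 3 k′

  last-n : suc last ≡ n
  last-n = trans (cong suc (ladder-≡ 3 k′)) (arith k′)
    where
    arith : ∀ k → suc (3 + 2 * k) ≡ 2 * suc (suc k)
    arith = solve-∀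

  three≤last : 3 ≤ last
  three≤last = subst (3 ≤_) (sym (ladder-≡ 3 k′)) (m≤m+n 3 (2 * k′))

  below : ∀ {t} → t ≤ last → t < n
  below {t} t≤last = subst (λ m → suc t ≤ m) last-n (s≤s t≤last)

  hub-fits : ∀ h → h ≤ k′ → neighbored (hub (ladder 3 h)) ⊆at ladder 3 h
  hub-fits h h≤k′ = paramsAt-fits neighboredKind (ladder 3 h) (below (ladder-mono 3 h≤k′))
    (cong (λ r → if r ≡ᵇ 0 then neighboredKind else pairedKind) (trans (cong (_% 2) (ladder-suc 3 h)) (ladder-parity 4 h)))

  gap-fits : ∀ h → h < k′ → paired (gap (suc (ladder 3 h))) ⊆at suc (ladder 3 h)
  gap-fits h h<k′ = paramsAt-fits pairedKind (suc (ladder 3 h)) (below (≤-trans (n≤1+n _) (ladder-mono 3 h<k′)))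
    (cong (λ r → if r ≡ᵇ 0 then neighboredKind else pairedKind) (ladder-parity 3 (suc h)))

  R B : Rel 3
  R = viaPaired (hub 1) (signs 1) (gap 2) (signs 2) (hub 3)
  B = viaPaired (hub last) (signs last) (gap 0) (signs 0) (hub 1)

  closedWalk : ∃₂ (λ a b → T (R a b) × T (B (route k′ ⟨$⟩ʳ b) a)) → Σ C λ x → Walk signs lists 0 x n x × x ∈S lists 0
  closedWalk (a , b , Rab , Bba) =
    around (viaPaired-sound (hub last) (signs last) (gap 0) (signs 0) (hub 1) (route k′ ⟨$⟩ʳ b) a Bba)
    where
    gap0-fits : paired (gap 0) ⊆at 0
    gap0-fits = paramsAt-fits pairedKind 0 (below z≤n) refl
    hub1-fits : neighbored (hub 1) ⊆at 1
    hub1-fits = paramsAt-fits neighboredKind 1 (below (≤-trans (s≤s z≤n) three≤last)) refl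
    around : Bridge (paired (gap 0)) (representative (hub last) (route k′ ⟨$⟩ʳ b)) (signs last) (signs 0) (representative (hub 1) a) →
             Σ C λ x → Walk signs lists 0 x n x × x ∈S lists 0
    around (x , x∈ , into-x , out-of-x) = x , subst (λ m → Walk signs lists 0 x m x) last-n walk , gap0-fits x x∈
      where
      walk : Walk signs lists 0 x (suc last) x
      walk = edge-walk out-of-x hub1-fits (representative-neighbored (hub 1) a)
          ++ bridge-walk (viaPaired-sound (hub 1) (signs 1) (gap 2) (signs 2) (hub 3) a b Rab)
                         (paramsAt-fits pairedKind 2 (below (≤-trans (n≤1+n 2) three≤last)) refl) (hub-fits 0 z≤n)
                         (representative-neighbored (hub 3) b)
          ++ chain-walk k′ hub-fits gap-fits b
          ++ edge-walk into-x (subst (paired (gap 0) ⊆at_) (sym last-n) (wrap gap0-fits)) x∈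

  colouring : LColorable n σ L
  colouring =
    let (x , w , x∈) = closedWalk (closed-route R B (route k′) large)
    in colourable w x∈
    where
    large : 3 * 3 < count R + count B
    large = +-mono-≤ (viaPaired-count (hub 1) (signs 1) (gap 2) (signs 2) (hub 3))
                     (viaPaired-count (hub last) (signs last) (gap 0) (signs 0) (hub 1))

-- Position 0 is full and 1 balanced; the hubs are 2, 4, …, n - 2 and n - 1, with paired 10-sets in between.
-- R runs from n - 1 through 0 and 1 to 2, the chain from 2 to n - 2, and B is the edge from n - 2 to n - 1.
module Case2 (k′ : ℕ) (σ : Fin (2 * suc (suc k′)) → Sgn) (L : Fin (2 * suc (suc k′)) → SubC)
             (cond : Cond2 (suc (suc k′)) L) where

  n : ℕ
  n = 2 * suc (suc k′)

  regular : ℕ → Kind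
  regular p = if isEven? p then pairedKind else neighboredKind

  kind : ℕ → Kind
  kind p = if p ≡ᵇ 1 then fullKind else if p ≡ᵇ 2 then balancedKind else if p ≡ᵇ n then neighboredKind else regular p

  hyp : ∀ i → KindHyp (kind (pos i)) (L i)
  hyp i with pos i ≡ᵇ 1 in e₁
  ... | true  = proj₁ (cond i) (≡ᵇ⇒≡ _ _ (subst T (sym e₁) tt))
  ... | false with pos i ≡ᵇ 2 in e₂
  ...   | true  = proj₁ (proj₂ (cond i)) (≡ᵇ⇒≡ _ _ (subst T (sym e₂) tt))
  ...   | false with pos i ≡ᵇ n in eₙ
  ...     | true  = proj₁ (proj₂ (proj₂ (cond i))) (≡ᵇ⇒≡ _ _ (subst T (sym eₙ) tt))
  ...     | false with parity (pos i)
  ...       | inj₁ even rewrite even = proj₁ (proj₂ (proj₂ (proj₂ (cond i))) (≡ᵇ-false⇒≢ e₁) (≡ᵇ-false⇒≢ e₂) (≡ᵇ-false⇒≢ eₙ)) even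
  ...       | inj₂ odd  rewrite odd  = proj₂ (proj₂ (proj₂ (proj₂ (cond i))) (≡ᵇ-false⇒≢ e₁) (≡ᵇ-false⇒≢ e₂) (≡ᵇ-false⇒≢ eₙ)) odd

  open Normalised n σ L kind hyp

  last : ℕ
  last = ladder 2 k′

  last-n : suc (suc last) ≡ n
  last-n = trans (cong (λ m → suc (suc m)) (ladder-≡ 2 k′)) (arith k′)
    where
    arith : ∀ k → suc (suc (2 + 2 * k)) ≡ 2 * suc (suc k)
    arith = solve-∀

  below : ∀ {t} → t ≤ suc last → t < n
  below {t} t≤ = subst (λ m → suc t ≤ m) last-n (s≤s t≤)

  kind-regular : ∀ p → 2 < p → p < n → kind p ≡ regular p
  kind-regular p 2<p p<n
    rewrite ≡ᵇ-false {p} {1} (>⇒≢ (≤-trans (s≤s (s≤s z≤n)) 2<p)) | ≡ᵇ-false {p} {2} (>⇒≢ 2<p) | ≡ᵇ-false {p} {n} (<⇒≢ p<n) = refl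

  kind-n : kind n ≡ neighboredKind
  kind-n rewrite ≡ᵇ-false {n} {2} (>⇒≢ (subst (2 <_) last-n (s≤s (s≤s (≤-trans (s≤s z≤n) (ladder-≥ 2 k′)))))) | ≡ᵇ-refl n = refl

  hub : ℕ → Hub
  hub = paramsAt neighboredKind

  gap : ℕ → Layer
  gap = paramsAt pairedKind

  open Chain 2 (hub ∘ ladder 2) (gap ∘ suc ∘ ladder 2)

  hub-fits : ∀ h → h ≤ k′ → neighbored (hub (ladder 2 h)) ⊆at ladder 2 h
  hub-fits h h≤k′ = paramsAt-fits neighboredKind (ladder 2 h) (below (≤-trans (ladder-mono 2 h≤k′) (n≤1+n last)))
    (trans (kind-regular (suc (ladder 2 h)) (s≤s (ladder-≥ 2 h)) (below (s≤s (ladder-mono 2 h≤k′))))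
           (cong (λ r → if r ≡ᵇ 0 then pairedKind else neighboredKind) (trans (cong (_% 2) (ladder-suc 2 h)) (ladder-parity 3 h))))

  gap-fits : ∀ h → h < k′ → paired (gap (suc (ladder 2 h))) ⊆at suc (ladder 2 h)
  gap-fits h h<k′ = paramsAt-fits pairedKind (suc (ladder 2 h)) (below (≤-trans (n≤1+n _) (≤-trans (ladder-mono 2 h<k′) (n≤1+n last))))
    (trans (kind-regular (ladder 2 (suc h)) (s≤s (s≤s (≤-trans (s≤s z≤n) (ladder-≥ 2 h)))) (below (≤-trans (ladder-mono 2 h<k′) (n≤1+n last))))
           (cong (λ r → if r ≡ᵇ 0 then pairedKind else neighboredKind) (ladder-parity 2 (suc h))))

  Y : ℕ
  Y = suc last

  full-fits : everything ⊆at 0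
  full-fits = paramsAt-fits fullKind 0 (below z≤n) refl

  balanced-fits : balanced (paramsAt balancedKind 1) ⊆at 1
  balanced-fits = paramsAt-fits balancedKind 1 (below (s≤s z≤n)) refl

  Y-fits : neighbored (hub Y) ⊆at Y
  Y-fits = paramsAt-fits neighboredKind Y (below ≤-refl) (trans (cong kind last-n) kind-n)

  R B : Rel 3
  R = viaFullBalanced (hub Y) (signs Y) (signs 0) (paramsAt balancedKind 1) (signs 1) (hub 2)
  B = adjacent (hub last) (signs last) (hub Y)

  closedWalk : ∃₂ (λ a b → T (R a b) × T (B (route k′ ⟨$⟩ʳ b) a)) → Σ C λ x → Walk signs lists 0 x n x × x ∈S lists 0
  closedWalk (a , b , Rab , Bba) =
    around (viaFullBalanced-sound (hub Y) (signs Y) (signs 0) (paramsAt balancedKind 1) (signs 1) (hub 2) a b Rab)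
    where
    around : Σ C (λ q → T (balanced (paramsAt balancedKind 1) q) × Bridge everything (representative (hub Y) a) (signs Y) (signs 0) q
                        × Edge q (signs 1) (representative (hub 2) b)) →
             Σ C λ x → Walk signs lists 0 x n x × x ∈S lists 0
    around (q , q∈ , (x , _ , into-x , x-q) , q-hub) = x , subst (λ m → Walk signs lists 0 x m x) last-n walk , full-fits x tt
      where
      walk : Walk signs lists 0 x (suc (suc last)) x
      walk = bridge-walk (q , q∈ , x-q , q-hub) balanced-fits (hub-fits 0 z≤n) (representative-neighbored (hub 2) b)
          ++ chain-walk k′ hub-fits gap-fits b
          ++ edge-walk (edge-sound Bba) Y-fits (representative-neighbored (hub Y) a)
          ++ edge-walk into-x (subst (everything ⊆at_) (sym last-n) (wrap full-fits)) tt

  colouring : LColorable n σ L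
  colouring =
    let (x , w , x∈) = closedWalk (closed-route R B (route k′) large)
    in colourable w x∈
    where
    large : 3 * 3 < count R + count B
    large = +-mono-≤ (viaFullBalanced-count (hub Y) (signs Y) (signs 0) (paramsAt balancedKind 1) (signs 1) (hub 2))
                     (adjacent-count (hub last) (signs last) (hub Y))

module Case3Kinds (k : ℕ) (L : Fin (2 * k) → SubC) (cond : Cond3 k L) where

  n : ℕ
  n = 2 * k

  regular : ℕ → Kind
  regular p = if isEven? p then pairedKind else neighboredKind

  kind : ℕ → Kind
  kind p = if p ≡ᵇ 1 then fullKind else if p ≡ᵇ 2 then neighboredKind else if p ≡ᵇ n then neighboredKind
           else if p ≡ᵇ 3 then balancedKind else regular p

  hyp : ∀ i → KindHyp (kind (pos i)) (L i)
  hyp i with pos i ≡ᵇ 1 in e₁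
  ... | true  = proj₁ (cond i) (≡ᵇ⇒≡ _ _ (subst T (sym e₁) tt))
  ... | false with pos i ≡ᵇ 2 in e₂
  ...   | true  = proj₁ (proj₂ (cond i)) (≡ᵇ⇒≡ _ _ (subst T (sym e₂) tt))
  ...   | false with pos i ≡ᵇ n in eₙ
  ...     | true  = proj₁ (proj₂ (proj₂ (cond i))) (≡ᵇ⇒≡ _ _ (subst T (sym eₙ) tt))
  ...     | false with pos i ≡ᵇ 3 in e₃
  ...       | true  = proj₁ (proj₂ (proj₂ (proj₂ (cond i)))) (≡ᵇ⇒≡ _ _ (subst T (sym e₃) tt))
  ...       | false with parity (pos i)
  ...         | inj₁ even rewrite even =
    proj₂ (proj₂ (proj₂ (proj₂ (proj₂ (cond i)))) (≡ᵇ-false⇒≢ e₁) (≡ᵇ-false⇒≢ e₂) (≡ᵇ-false⇒≢ e₃) (≡ᵇ-false⇒≢ eₙ)) even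
  ...         | inj₂ odd  rewrite odd  =
    proj₁ (proj₂ (proj₂ (proj₂ (proj₂ (cond i)))) (≡ᵇ-false⇒≢ e₁) (≡ᵇ-false⇒≢ e₂) (≡ᵇ-false⇒≢ e₃) (≡ᵇ-false⇒≢ eₙ)) odd

module Case3Square (σ : Fin 4 → Sgn) (L : Fin 4 → SubC) (cond : Cond3 2 L) where
  open Case3Kinds 2 L cond
  open Normalised 4 σ L kind hyp

  A Y : Hub
  A = paramsAt neighboredKind 1
  Y = paramsAt neighboredKind 3

  colouring : LColorable 4 σ L
  colouring = around (square-closes A (signs 1) (paramsAt balancedKind 2) (signs 2) Y (signs 3) (signs 0))
    where
    full-fits : everything ⊆at 0
    full-fits = paramsAt-fits fullKind 0 (s≤s z≤n) refl
    around : (Σ (Layer × Layer) λ (l , l') → Bridge (balanced (paramsAt balancedKind 2)) (representative A l) (signs 1) (signs 2) (representative Y l')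
                                            × Bridge everything (representative Y l') (signs 3) (signs 0) (representative A l)) →
             LColorable 4 σ L
    around ((l , l') , outward , (x , _ , into-x , out-of-x)) = colourable
      (edge-walk out-of-x (paramsAt-fits neighboredKind 1 (s≤s (s≤s z≤n)) refl) (representative-neighbored A l)
       ++ bridge-walk outward (paramsAt-fits balancedKind 2 (s≤s (s≤s (s≤s z≤n))) refl)
                              (paramsAt-fits neighboredKind 3 ≤-refl refl) (representative-neighbored Y l')
       ++ edge-walk into-x (wrap full-fits) tt)
      (full-fits x tt)

-- Position 0 is full and 2 balanced; the hubs are 1 and 4, 6, …, n - 2, with paired 10-sets at 3, 5, …, and
-- n - 1 is neighbored. R runs from 1 through 2 and 3 to 4, the chain from 4 to n - 2, and B from n - 2 through
-- n - 1 and 0 back to 1.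
module Case3 (k″ : ℕ) (σ : Fin (2 * suc (suc (suc k″))) → Sgn) (L : Fin (2 * suc (suc (suc k″))) → SubC)
             (cond : Cond3 (suc (suc (suc k″))) L) where
  open Case3Kinds (suc (suc (suc k″))) L cond
  open Normalised n σ L kind hyp

  last : ℕ
  last = ladder 4 k″

  last-n : suc (suc last) ≡ n
  last-n = trans (cong (λ m → suc (suc m)) (ladder-≡ 4 k″)) (arith k″)
    where
    arith : ∀ k → suc (suc (4 + 2 * k)) ≡ 2 * suc (suc (suc k))
    arith = solve-∀

  below : ∀ {t} → t ≤ suc last → t < n
  below {t} t≤ = subst (λ m → suc t ≤ m) last-n (s≤s t≤)

  five≤n : 5 < n
  five≤n = below (s≤s (ladder-≥ 4 k″))

  early : ∀ {t} → t ≤ 4 → t < n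
  early t≤4 = below (≤-trans t≤4 (≤-trans (ladder-≥ 4 k″) (n≤1+n last)))

  kind-regular : ∀ p → 3 < p → p < n → kind p ≡ regular p
  kind-regular p 3<p p<n
    rewrite ≡ᵇ-false {p} {1} (>⇒≢ (≤-trans (s≤s (s≤s z≤n)) 3<p)) | ≡ᵇ-false {p} {2} (>⇒≢ (≤-trans (s≤s (s≤s (s≤s z≤n))) 3<p))
          | ≡ᵇ-false {p} {n} (<⇒≢ p<n) | ≡ᵇ-false {p} {3} (>⇒≢ 3<p) = refl

  kind-3 : kind 3 ≡ balancedKind
  kind-3 rewrite ≡ᵇ-false {3} {n} (<⇒≢ (≤-trans (s≤s (s≤s (s≤s (s≤s z≤n)))) five≤n)) = refl

  kind-n : kind n ≡ neighboredKind
  kind-n rewrite ≡ᵇ-false {n} {1} (>⇒≢ (≤-trans (s≤s (s≤s z≤n)) five≤n)) | ≡ᵇ-false {n} {2} (>⇒≢ (≤-trans (s≤s (s≤s (s≤s z≤n))) five≤n))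
               | ≡ᵇ-refl n = refl

  hub : ℕ → Hub
  hub = paramsAt neighboredKind

  gap : ℕ → Layer
  gap = paramsAt pairedKind

  open Chain 4 (hub ∘ ladder 4) (gap ∘ suc ∘ ladder 4)

  hub-fits : ∀ h → h ≤ k″ → neighbored (hub (ladder 4 h)) ⊆at ladder 4 h
  hub-fits h h≤k″ = paramsAt-fits neighboredKind (ladder 4 h) (below (≤-trans (ladder-mono 4 h≤k″) (n≤1+n last)))
    (trans (kind-regular (suc (ladder 4 h)) (s≤s (≤-trans (n≤1+n 3) (ladder-≥ 4 h))) (below (s≤s (ladder-mono 4 h≤k″))))
           (cong (λ r → if r ≡ᵇ 0 then pairedKind else neighboredKind) (trans (cong (_% 2) (ladder-suc 4 h)) (ladder-parity 5 h))))

  gap-fits : ∀ h → h < k″ → paired (gap (suc (ladder 4 h))) ⊆at suc (ladder 4 h)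
  gap-fits h h<k″ = paramsAt-fits pairedKind (suc (ladder 4 h)) (below (≤-trans (n≤1+n _) (≤-trans (ladder-mono 4 h<k″) (n≤1+n last))))
    (trans (kind-regular (ladder 4 (suc h)) (s≤s (s≤s (≤-trans (s≤s (s≤s z≤n)) (ladder-≥ 4 h)))) (below (≤-trans (ladder-mono 4 h<k″) (n≤1+n last))))
           (cong (λ r → if r ≡ᵇ 0 then pairedKind else neighboredKind) (ladder-parity 4 (suc h))))

  A Y : ℕ
  A = 1
  Y = suc last

  full-fits : everything ⊆at 0
  full-fits = paramsAt-fits fullKind 0 (early z≤n) refl

  A-fits : neighbored (hub A) ⊆at A
  A-fits = paramsAt-fits neighboredKind A (early (s≤s z≤n)) refl

  balanced-fits : balanced (paramsAt balancedKind 2) ⊆at 2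
  balanced-fits = paramsAt-fits balancedKind 2 (early (s≤s (s≤s z≤n))) kind-3

  paired-fits : paired (gap 3) ⊆at 3
  paired-fits = paramsAt-fits pairedKind 3 (early (s≤s (s≤s (s≤s z≤n)))) (kind-regular 4 ≤-refl (≤-trans (s≤s (s≤s (s≤s (s≤s (s≤s z≤n))))) five≤n))

  Y-fits : neighbored (hub Y) ⊆at Y
  Y-fits = paramsAt-fits neighboredKind Y (below ≤-refl) (trans (cong kind last-n) kind-n)

  R B : Rel 3
  R = viaBalancedPaired (hub A) (signs 1) (paramsAt balancedKind 2) (signs 2) (gap 3) (signs 3) (hub 4)
  B = viaNeighboredFull (hub last) (signs last) (hub Y) (signs Y) (signs 0) (hub A)

  closedWalk : ∃₂ (λ a b → T (R a b) × T (B (route k″ ⟨$⟩ʳ b) a)) → Σ C λ x → Walk signs lists 0 x n x × x ∈S lists 0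
  closedWalk (a , b , Rab , Bba) =
    around (viaBalancedPaired-sound (hub A) (signs 1) (paramsAt balancedKind 2) (signs 2) (gap 3) (signs 3) (hub 4) a b Rab)
           (viaNeighboredFull-sound (hub last) (signs last) (hub Y) (signs Y) (signs 0) (hub A) (route k″ ⟨$⟩ʳ b) a Bba)
    where
    around : (Σ C λ q → T (balanced (paramsAt balancedKind 2) q) × Edge (representative (hub A) a) (signs 1) q
                        × Bridge (paired (gap 3)) q (signs 2) (signs 3) (representative (hub 4) b)) →
             (Σ C λ y → T (neighbored (hub Y) y) × Edge (representative (hub last) (route k″ ⟨$⟩ʳ b)) (signs last) y
                        × Bridge everything y (signs Y) (signs 0) (representative (hub A) a)) →
             Σ C λ x → Walk signs lists 0 x n x × x ∈S lists 0
    around (q , q∈ , A-q , onward) (y , y∈ , last-y , (x , _ , y-x , x-A)) =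
      x , subst (λ m → Walk signs lists 0 x m x) last-n walk , full-fits x tt
      where
      walk : Walk signs lists 0 x (suc (suc last)) x
      walk = edge-walk x-A A-fits (representative-neighbored (hub A) a)
          ++ edge-walk A-q balanced-fits q∈
          ++ bridge-walk onward paired-fits (hub-fits 0 z≤n) (representative-neighbored (hub 4) b)
          ++ chain-walk k″ hub-fits gap-fits b
          ++ edge-walk last-y Y-fits y∈
          ++ edge-walk y-x (subst (everything ⊆at_) (sym last-n) (wrap full-fits)) tt

  colouring : LColorable n σ L
  colouring =
    let (x , w , x∈) = closedWalk (closed-route R B (route k″) large)
    in colourable w x∈
    where
    large : 3 * 3 < count R + count B
    large = +-mono-≤ (viaBalancedPaired-count (hub A) (signs 1) (paramsAt balancedKind 2) (signs 2) (gap 3) (signs 3) (hub 4))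
                     (viaNeighboredFull-count (hub last) (signs last) (hub Y) (signs Y) (signs 0) (hub A))

lemma4p10 : (k : ℕ) → 2 ≤ k → (σ : Fin (2 * k) → Sgn) → (L : Fin (2 * k) → SubC) →
    Cond1 k L ⊎ Cond2 k L ⊎ Cond3 k L → LColorable (2 * k) σ L
lemma4p10 (suc (suc k′))        (s≤s (s≤s _)) σ L (inj₁ cond)        = Case1.colouring k′ σ L cond
lemma4p10 (suc (suc k′))        (s≤s (s≤s _)) σ L (inj₂ (inj₁ cond)) = Case2.colouring k′ σ L cond
lemma4p10 (suc (suc zero))      (s≤s (s≤s _)) σ L (inj₂ (inj₂ cond)) = Case3Square.colouring σ L cond
lemma4p10 (suc (suc (suc k″))) (s≤s (s≤s _)) σ L (inj₂ (inj₂ cond)) = Case3.colouring k″ σ L cond
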